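{- For all $n,r\in\mathbb{N}$, $\mathrm{Li}^-_{y_0^ny_r}=(\mathrm{Li}^-_{y_0})^n\,\mathrm{Li}^-_{y_r}$, where $y_0^ny_r$ denotes the word $y_0\cdots y_0y_r$ with $n$ letters $y_0$.
   Context: $\mathbb{N}$ is the set of non-negative integers. For $r\ge0$ and $\mathbf{s}=(s_1,\ldots,s_r)\in\mathbb{N}^r$ put $\mathrm{Li}^-_{\mathbf{s}}(z):=\sum_{n_1>\cdots>n_r>0}n_1^{s_1}\cdots n_r^{s_r}z^{n_1}$ for $|z|<1$ (the empty index gives $1$); each is a rational function in $\mathbb{Q}[z,(1-z)^{ -1}]$, and products are products of these functions. For a word $w=y_{s_1}\cdots y_{s_r}$ in the free monoid on $Y=\{y_0,y_1,y_2,\ldots\}$ set $\mathrm{Li}^-_w:=\mathrm{Li}^-_{(s_1,\ldots,s_r)}$, and $\mathrm{Li}^-_w:=1$ for the empty word. -}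

module Defs where

open import Data.Nat using (ℕ; zero; suc; _+_; _*_; _∸_; _^_)
open import Data.List using (List; []; _∷_)
open import Relation.Binary.PropositionalEquality using (_≡_)

-- Formal power series in z with natural-number coefficients,
-- represented by their coefficient sequence: f ↦ (m ↦ [z^m] f).
Series : Set
Series = ℕ → ℕ

sumUpTo : (ℕ → ℕ) → ℕ → ℕ
sumUpTo f zero    = f zero
sumUpTo f (suc k) = sumUpTo f k + f (suc k)

-- Words on Y = {y_0, y_1, ...}: the word y_{s_1} ... y_{s_r} is the list s_1 ∷ ... ∷ s_r ∷ [].
Word : Set
Word = List ℕ

y0^_y_ : ℕ → ℕ → Word
y0^ zero  y r = r ∷ []
y0^ suc n y r = 0 ∷ (y0^ n y r)

-- Taylor coefficients of Li^-_w at z = 0: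
--   [z^m] Li^-_{(s_1,...,s_r)} = Σ_{m = n_1 > n_2 > ... > n_r > 0} n_1^{s_1} ... n_r^{s_r},
-- and Li^-_{empty} = 1.
Li⁻ : Word → Series
Li⁻ []       zero    = 1
Li⁻ []       (suc m) = 0
Li⁻ (s ∷ w)  zero    = 0
Li⁻ (s ∷ w)  (suc k) = (suc k) ^ s * sumUpTo (Li⁻ w) k

_⊛_ : Series → Series → Series
(f ⊛ g) m = sumUpTo (λ i → f i * g (m ∸ i)) m

one : Series
one zero    = 1
one (suc _) = 0

_^ˢ_ : Series → ℕ → Series
f ^ˢ zero  = one
f ^ˢ suc n = f ⊛ (f ^ˢ n)

_≐_ : Series → Series → Set
f ≐ g = (m : ℕ) → f m ≡ g m

-- Prepending y₀ to a word multiplies its series by z/(1-z), i.e. replaces the coefficients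
-- by their partial sums, and z/(1-z) is itself Li⁻_{y₀}. Hence Li⁻_{y₀ⁿ yᵣ} = (z/(1-z))ⁿ Li⁻_{yᵣ}
-- by induction on n, the inductive step being the associativity instance
-- (z/(1-z) · P) · R = z/(1-z) · (P · R).
{-# OPTIONS --safe #-}
module Submission where

open import Defs
open import Data.Nat using (ℕ; zero; suc; _+_; _*_; _∸_)
open import Data.Nat.Properties
  using (+-assoc; +-comm; +-identityʳ; *-identityˡ; *-distribʳ-+; +-commutativeSemigroup)
open import Data.List using ([]; _∷_)
open import Algebra.Properties.CommutativeSemigroup +-commutativeSemigroup using (interchange)
open import Relation.Binary.PropositionalEquality using (_≡_; refl; sym; trans; cong; cong₂)
open Relation.Binary.PropositionalEquality.≡-Reasoning

sumUpTo-cong : ∀ {f g : ℕ → ℕ} → (∀ i → f i ≡ g i) → ∀ m → sumUpTo f m ≡ sumUpTo g m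
sumUpTo-cong f≗g zero    = f≗g zero
sumUpTo-cong f≗g (suc m) = cong₂ _+_ (sumUpTo-cong f≗g m) (f≗g (suc m))

sumUpTo-shift : ∀ (f : ℕ → ℕ) m → sumUpTo f (suc m) ≡ f 0 + sumUpTo (λ i → f (suc i)) m
sumUpTo-shift f zero    = refl
sumUpTo-shift f (suc m) = begin
  sumUpTo f (suc m) + f (suc (suc m))
    ≡⟨ cong (_+ f (suc (suc m))) (sumUpTo-shift f m) ⟩
  f 0 + sumUpTo (λ i → f (suc i)) m + f (suc (suc m))
    ≡⟨ +-assoc (f 0) _ _ ⟩
  f 0 + sumUpTo (λ i → f (suc i)) (suc m) ∎

sumUpTo-distrib-+ : ∀ (f g : ℕ → ℕ) m →
                    sumUpTo (λ i → f i + g i) m ≡ sumUpTo f m + sumUpTo g m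
sumUpTo-distrib-+ f g zero    = refl
sumUpTo-distrib-+ f g (suc m) = begin
  sumUpTo (λ i → f i + g i) m + (f (suc m) + g (suc m))
    ≡⟨ cong (_+ (f (suc m) + g (suc m))) (sumUpTo-distrib-+ f g m) ⟩
  sumUpTo f m + sumUpTo g m + (f (suc m) + g (suc m))
    ≡⟨ interchange (sumUpTo f m) (sumUpTo g m) (f (suc m)) (g (suc m)) ⟩
  sumUpTo f (suc m) + sumUpTo g (suc m) ∎

sumUpTo-zero : ∀ m → sumUpTo (λ _ → 0) m ≡ 0
sumUpTo-zero zero    = refl
sumUpTo-zero (suc m) = cong (_+ 0) (sumUpTo-zero m)

sumUpTo-reverse : ∀ (f : ℕ → ℕ) m → sumUpTo (λ i → f (m ∸ i)) m ≡ sumUpTo f m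
sumUpTo-reverse f zero    = refl
sumUpTo-reverse f (suc m) = begin
  sumUpTo (λ i → f (suc m ∸ i)) (suc m) ≡⟨ sumUpTo-shift (λ i → f (suc m ∸ i)) m ⟩
  f (suc m) + sumUpTo (λ i → f (m ∸ i)) m ≡⟨ cong (f (suc m) +_) (sumUpTo-reverse f m) ⟩
  f (suc m) + sumUpTo f m                 ≡⟨ +-comm (f (suc m)) _ ⟩
  sumUpTo f (suc m)                       ∎

-- The coefficients of z/(1-z) · F.
prefixSums : Series → Series
prefixSums F zero    = 0
prefixSums F (suc k) = sumUpTo F k

prefixSums-suc : ∀ F i → prefixSums F (suc i) ≡ prefixSums F i + F i
prefixSums-suc F zero    = refl
prefixSums-suc F (suc i) = refl

prefixSums-cong : ∀ {F G} → F ≐ G → prefixSums F ≐ prefixSums G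
prefixSums-cong F≐G zero    = refl
prefixSums-cong F≐G (suc k) = sumUpTo-cong F≐G k

⊛-congˡ : ∀ {F G} R → F ≐ G → (F ⊛ R) ≐ (G ⊛ R)
⊛-congˡ R F≐G m = sumUpTo-cong (λ i → cong (_* R (m ∸ i)) (F≐G i)) m

⊛-identityˡ : ∀ R → (one ⊛ R) ≐ R
⊛-identityˡ R zero    = +-identityʳ _
⊛-identityˡ R (suc m) = begin
  sumUpTo (λ i → one i * R (suc m ∸ i)) (suc m) ≡⟨ sumUpTo-shift (λ i → one i * R (suc m ∸ i)) m ⟩
  R (suc m) + 0 + sumUpTo (λ _ → 0) m           ≡⟨ cong₂ _+_ (+-identityʳ _) (sumUpTo-zero m) ⟩
  R (suc m) + 0                                 ≡⟨ +-identityʳ _ ⟩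
  R (suc m)                                     ∎

prefixSums-⊛-suc : ∀ P R m →
                   (prefixSums P ⊛ R) (suc m) ≡ (prefixSums P ⊛ R) m + (P ⊛ R) m
prefixSums-⊛-suc P R m = begin
  sumUpTo (λ i → prefixSums P i * R (suc m ∸ i)) (suc m)
    ≡⟨ sumUpTo-shift (λ i → prefixSums P i * R (suc m ∸ i)) m ⟩
  sumUpTo (λ i → prefixSums P (suc i) * R (m ∸ i)) m
    ≡⟨ sumUpTo-cong split m ⟩
  sumUpTo (λ i → prefixSums P i * R (m ∸ i) + P i * R (m ∸ i)) m
    ≡⟨ sumUpTo-distrib-+ (λ i → prefixSums P i * R (m ∸ i)) (λ i → P i * R (m ∸ i)) m ⟩
  (prefixSums P ⊛ R) m + (P ⊛ R) m ∎
  where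
  split : ∀ i → prefixSums P (suc i) * R (m ∸ i) ≡ prefixSums P i * R (m ∸ i) + P i * R (m ∸ i)
  split i = trans (cong (_* R (m ∸ i)) (prefixSums-suc P i))
                  (*-distribʳ-+ (R (m ∸ i)) (prefixSums P i) (P i))

prefixSums-⊛ : ∀ P R → (prefixSums P ⊛ R) ≐ prefixSums (P ⊛ R)
prefixSums-⊛ P R zero    = refl
prefixSums-⊛ P R (suc m) = begin
  (prefixSums P ⊛ R) (suc m)           ≡⟨ prefixSums-⊛-suc P R m ⟩
  (prefixSums P ⊛ R) m + (P ⊛ R) m     ≡⟨ cong (_+ (P ⊛ R) m) (prefixSums-⊛ P R m) ⟩
  prefixSums (P ⊛ R) m + (P ⊛ R) m     ≡⟨ sym (prefixSums-suc (P ⊛ R) m) ⟩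
  prefixSums (P ⊛ R) (suc m)           ∎

Li⁻-y₀∷ : ∀ w → Li⁻ (0 ∷ w) ≐ prefixSums (Li⁻ w)
Li⁻-y₀∷ w zero    = refl
Li⁻-y₀∷ w (suc k) = +-identityʳ _

Li⁻-y₀-suc : ∀ k → Li⁻ (0 ∷ []) (suc k) ≡ 1
Li⁻-y₀-suc k = trans (Li⁻-y₀∷ [] (suc k)) (sumUpTo-empty k)
  where
  sumUpTo-empty : ∀ k → sumUpTo (Li⁻ []) k ≡ 1
  sumUpTo-empty zero    = refl
  sumUpTo-empty (suc k) = cong (_+ 0) (sumUpTo-empty k)

Li⁻-y₀-⊛ : ∀ F → (Li⁻ (0 ∷ []) ⊛ F) ≐ prefixSums F
Li⁻-y₀-⊛ F zero    = refl
Li⁻-y₀-⊛ F (suc m) = begin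
  sumUpTo (λ i → Li⁻ (0 ∷ []) i * F (suc m ∸ i)) (suc m)
    ≡⟨ sumUpTo-shift (λ i → Li⁻ (0 ∷ []) i * F (suc m ∸ i)) m ⟩
  sumUpTo (λ i → Li⁻ (0 ∷ []) (suc i) * F (m ∸ i)) m
    ≡⟨ sumUpTo-cong (λ i → trans (cong (_* F (m ∸ i)) (Li⁻-y₀-suc i)) (*-identityˡ _)) m ⟩
  sumUpTo (λ i → F (m ∸ i)) m
    ≡⟨ sumUpTo-reverse F m ⟩
  sumUpTo F m ∎

corollary4p3 : (n r : ℕ) → Li⁻ (y0^ n y r) ≐ ((Li⁻ (0 ∷ []) ^ˢ n) ⊛ Li⁻ (r ∷ []))
corollary4p3 zero    r m = sym (⊛-identityˡ (Li⁻ (r ∷ [])) m)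
corollary4p3 (suc n) r m = begin
  Li⁻ (0 ∷ y0^ n y r) m                  ≡⟨ Li⁻-y₀∷ (y0^ n y r) m ⟩
  prefixSums (Li⁻ (y0^ n y r)) m         ≡⟨ prefixSums-cong (corollary4p3 n r) m ⟩
  prefixSums ((L₀ ^ˢ n) ⊛ Lᵣ) m          ≡⟨ sym (prefixSums-⊛ (L₀ ^ˢ n) Lᵣ m) ⟩
  (prefixSums (L₀ ^ˢ n) ⊛ Lᵣ) m          ≡⟨ ⊛-congˡ Lᵣ (λ i → sym (Li⁻-y₀-⊛ (L₀ ^ˢ n) i)) m ⟩
  ((L₀ ⊛ (L₀ ^ˢ n)) ⊛ Lᵣ) m              ∎
  where
  L₀ Lᵣ : Series
  L₀ = Li⁻ (0 ∷ [])
  Lᵣ = Li⁻ (r ∷ [])
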